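{- Consider a feasible instance of the single-machine preemptive calibration problem with a set of $n$ jobs, job $j$ having integer release date $r_j$, integer deadline $d_j$ and positive integer processing time $p_j$, and calibration length $T$. Let $P=\sum_{j=1}^n p_j$ and $\Psi := \bigcup_{i=1}^n \{ d_i-P, d_i-P+1,\ldots, d_i \}$. Then there exists an optimal schedule (one minimizing the number of calibrations) in which every calibration starts at a time in $\Psi$.
   Context: Single-machine calibration model (discrete time): time is divided into unit slots $[t,t+1)$, $t$ integer. A calibration may be performed at any integer time $t$; it is instantaneous, costs $1$, and keeps the machine calibrated during $[t,t+T)$. In each slot the machine processes at most one unit of at most one job, and only if the machine is calibrated during that slot. Preemption is allowed: job $j$ must receive $p_j$ slots (not necessarily consecutive), all contained in $[r_j,d_j)$. A schedule is feasible if every job is fully processed in this way; the objective is to minimize the number of calibrations. -}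

module Defs where

open import Data.Nat using (ℕ)
open import Data.Fin using (Fin)
open import Data.Integer using (ℤ; _+_; _-_; _≤_; _<_; +_)
open import Data.List using (List; length; map)
open import Data.Nat.ListAction using (sum)
open import Data.List.Relation.Unary.All using (All)
open import Data.List.Relation.Unary.Any using (Any)
open import Data.List.Relation.Unary.Unique.Propositional using (Unique)
open import Data.List.Membership.Propositional using (_∈_)
open import Data.List.Base using (allFin)
open import Data.Product using (Σ; ∃; _×_)
open import Relation.Binary.PropositionalEquality using (_≡_)
open import Relation.Nullary using (¬_)

-- An instance with n jobs: release dates r, deadlines d (integers),
-- processing times p (natural numbers; positivity is a hypothesis of the theorem).
record Instance (n : ℕ) : Set where
  field
    r : Fin n → ℤ
    d : Fin n → ℤ
    p : Fin n → ℕ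

-- Time slot t = [t, t+1) is calibrated by a calibration at time c iff c ≤ t < c + T.
CalibratedBy : ℕ → ℤ → ℤ → Set
CalibratedBy T c t = c ≤ t × t < c + + T

Calibrated : ℕ → List ℤ → ℤ → Set
Calibrated T cals t = Any (λ c → CalibratedBy T c t) cals

-- A schedule: a list of calibration times (its length is the number of calibrations,
-- i.e. the cost) and, for every job j, the list of slots in which j is processed.
record Schedule (n : ℕ) : Set where
  field
    cals  : List ℤ
    slots : Fin n → List ℤ

open Schedule public

record Feasible {n : ℕ} (I : Instance n) (T : ℕ) (S : Schedule n) : Set where
  open Instance I
  field
    count    : ∀ j → length (slots S j) ≡ p j
    distinct : ∀ j → Unique (slots S j)
    window   : ∀ j → All (λ t → r j ≤ t × t < d j) (slots S j)
    calib    : ∀ j → All (Calibrated T (cals S)) (slots S j)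
    disjoint : ∀ i j t → t ∈ slots S i → t ∈ slots S j → i ≡ j

Optimal : {n : ℕ} → Instance n → ℕ → Schedule n → Set
Optimal I T S = Feasible I T S × (∀ S′ → Feasible I T S′ → length (cals S) Data.Nat.≤ length (cals S′))

totalP : {n : ℕ} → Instance n → ℕ
totalP {n} I = sum (map (Instance.p I) (allFin n))

InΨ : {n : ℕ} → Instance n → ℤ → Set
InΨ {n} I c = ∃ λ (i : Fin n) → (Instance.d I i - + totalP I ≤ c) × (c ≤ Instance.d I i)

module Submission where

-- A calibration c outside Ψ that still precedes some deadline lies more than P slots
-- before every deadline d ≥ c.  Only P slots are busy, so one slot e ∈ [c, c + P] is
-- idle; bumping every calibration and every busy slot of [c, e] one step to the right
-- keeps the schedule feasible (the idle slot absorbs the shift, and moved slots stay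
-- below c + P < d) and costs nothing, moves c towards the deadlines and never moves a
-- calibration out of Ψ.  Repeating this, every calibration ends up in Ψ or after all
-- deadlines, where it serves no slot and can be dropped.  So each feasible schedule is
-- dominated by one calibrating only in Ψ; those of bounded cost form a finite decidable
-- family, whose cheapest member is therefore optimal.

open import Defs
open import Data.Nat as ℕ using (ℕ; zero; suc; z≤n; s≤s)
import Data.Nat.Properties as ℕP
open import Data.Nat.Induction using (<-wellFounded)
open import Data.Nat.ListAction using (sum)
open import Data.Integer as ℤ using (ℤ; +_; _+_; _-_; -_; _≤_; _<_; _≤?_; _<?_; 0ℤ; 1ℤ; +<+)
  renaming (suc to sucℤ)
import Data.Integer.Properties as ℤP
open import Data.Integer.Tactic.RingSolver using (solve-∀)
open import Data.Fin as Fin using (Fin)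
import Data.Fin.Properties as FinP
open import Data.List using (List; []; _∷_; [_]; length; map; concatMap; filter; allFin; upTo; _++_)
import Data.List.Properties as ListP
open import Data.List.Extrema ℤP.≤-totalOrder using (max; xs≤max)
open import Data.List.Extrema.Nat using (argmin; argmin-all; f[argmin]≤f[⊤]; f[argmin]≤f[xs])
open import Data.List.Relation.Unary.All as All using (All; []; _∷_)
import Data.List.Relation.Unary.All.Properties as AllP
open import Data.List.Relation.Unary.Any as Any using (Any; here; there)
import Data.List.Relation.Unary.Any.Properties as AnyP
open import Data.List.Relation.Unary.AllPairs using ([]; _∷_)
open import Data.List.Relation.Unary.Unique.Propositional using (Unique)
import Data.List.Relation.Unary.Unique.Propositional.Properties as UniqueP
open import Data.List.Relation.Unary.Unique.DecPropositional ℤ._≟_ using (unique?)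
open import Data.List.Membership.Propositional using (_∈_; _∉_; lose; find)
open import Data.List.Membership.Propositional.Properties
open import Data.List.Membership.DecPropositional ℤ._≟_ using (_∈?_)
open import Data.List.Relation.Binary.Subset.Propositional using (_⊆_)
open import Data.Vec.Functional as Vector using (Vector)
open import Data.Product using (∃; _×_; _,_; proj₁)
open import Data.Sum using (_⊎_; inj₁; inj₂)
open import Data.Empty using (⊥-elim)
open import Function using (_∘_)
open import Induction.WellFounded using (Acc; acc)
open import Relation.Unary using (Decidable)
open import Relation.Nullary using (¬_; ¬?; Dec; yes; no)
open import Relation.Nullary.Decidable using (_×-dec_; _→-dec_; map′; decidable-stable)
open import Relation.Binary.PropositionalEquality hiding ([_])

private variable
  A B : Set

Unique-⊆⇒length≤ : {xs ys : List A} → Unique xs → xs ⊆ ys → length xs ℕ.≤ length ys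
Unique-⊆⇒length≤ {xs = []} _ _ = z≤n
Unique-⊆⇒length≤ {xs = x ∷ xs} (x∉xs ∷ xs!) xs⊆ys with ∈-∃++ (xs⊆ys (here refl))
... | pre , post , refl = begin
  suc (length xs)            ≤⟨ s≤s (Unique-⊆⇒length≤ xs! xs⊆pre++post) ⟩
  suc (length (pre ++ post)) ≡⟨ ListP.length-++-sucʳ pre x post ⟨
  length (pre ++ x ∷ post)   ∎
  where
  open ℕP.≤-Reasoning
  xs⊆pre++post : xs ⊆ pre ++ post
  xs⊆pre++post {y} y∈xs with ∈-++⁻ pre (xs⊆ys (there y∈xs))
  ... | inj₁ y∈pre          = ∈-++⁺ˡ y∈pre
  ... | inj₂ (here refl)    = ⊥-elim (All.lookup x∉xs y∈xs refl)
  ... | inj₂ (there y∈post) = ∈-++⁺ʳ pre y∈post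

Unique-map⁺-on : (f : A → B) {xs : List A} →
  (∀ {x y} → x ∈ xs → y ∈ xs → f x ≡ f y → x ≡ y) → Unique xs → Unique (map f xs)
Unique-map⁺-on f {[]} _ [] = []
Unique-map⁺-on f {x ∷ xs} inj (x∉xs ∷ xs!) =
  AllP.map⁺ (All.tabulate λ y∈xs fx≡fy → All.lookup x∉xs y∈xs (inj (here refl) (there y∈xs) fx≡fy))
  ∷ Unique-map⁺-on f (λ x∈ y∈ → inj (there x∈) (there y∈)) xs!

sum-map-≤ : (f g : A → ℕ) (xs : List A) → All (λ x → f x ℕ.≤ g x) xs → sum (map f xs) ℕ.≤ sum (map g xs)
sum-map-≤ f g []       []            = z≤n
sum-map-≤ f g (x ∷ xs) (fx≤gx ∷ f≤g) = ℕP.+-mono-≤ fx≤gx (sum-map-≤ f g xs f≤g)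

sum-map-< : (f g : A → ℕ) (xs : List A) → All (λ x → f x ℕ.≤ g x) xs → Any (λ x → f x ℕ.< g x) xs →
  sum (map f xs) ℕ.< sum (map g xs)
sum-map-< f g (x ∷ xs) (_ ∷ f≤g) (here fx<gx) = ℕP.+-mono-<-≤ fx<gx (sum-map-≤ f g xs f≤g)
sum-map-< f g (x ∷ xs) (fx≤gx ∷ f≤g) (there f<g) = ℕP.+-mono-≤-< fx≤gx (sum-map-< f g xs f≤g f<g)

length-concatMap : (f : A → List B) (xs : List A) →
  length (concatMap f xs) ≡ sum (map (λ x → length (f x)) xs)
length-concatMap f []       = refl
length-concatMap f (x ∷ xs) =
  trans (ListP.length-++ (f x)) (cong (length (f x) ℕ.+_) (length-concatMap f xs))

listsOfLength : ℕ → List A → List (List A)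
listsOfLength zero    L = [ [] ]
listsOfLength (suc k) L = concatMap (λ x → map (x ∷_) (listsOfLength k L)) L

∈-listsOfLength : {L xs : List A} → All (_∈ L) xs → xs ∈ listsOfLength (length xs) L
∈-listsOfLength []            = here refl
∈-listsOfLength {L = L} {_ ∷ xs} (x∈L ∷ xs⊆L) =
  ∈-concatMap⁺ (λ x → map (x ∷_) (listsOfLength (length xs) L))
    (lose x∈L (∈-map⁺ (_ ∷_) (∈-listsOfLength xs⊆L)))

listsOfLength≤ : ℕ → List A → List (List A)
listsOfLength≤ k L = concatMap (λ m → listsOfLength m L) (upTo (suc k))

∈-listsOfLength≤ : ∀ {k} {L xs : List A} → length xs ℕ.≤ k → All (_∈ L) xs → xs ∈ listsOfLength≤ k L
∈-listsOfLength≤ {L = L} ≤k xs⊆L =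
  ∈-concatMap⁺ (λ m → listsOfLength m L) (lose (∈-upTo⁺ (s≤s ≤k)) (∈-listsOfLength xs⊆L))

choices : ∀ {n} → ((j : Fin n) → List A) → List (Vector A n)
choices {n = zero}  C = [ Vector.[] ]
choices {n = suc n} C = concatMap (λ x → map (x Vector.∷_) (choices (Vector.tail C))) (Vector.head C)

∈-choices : ∀ {n} (C : (j : Fin n) → List A) {f : Vector A n} → (∀ j → f j ∈ C j) →
  ∃ λ g → g ∈ choices C × (∀ j → g j ≡ f j)
∈-choices {n = zero}  C f∈C = Vector.[] , here refl , λ ()
∈-choices {n = suc n} C {f} f∈C with ∈-choices (Vector.tail C) (λ j → f∈C (Fin.suc j))
... | g , g∈ , g≗ = Vector.head f Vector.∷ g ,
  ∈-concatMap⁺ (λ x → map (x Vector.∷_) (choices (Vector.tail C))) (lose (f∈C Fin.zero) (∈-map⁺ _ g∈)) ,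
  λ { Fin.zero → refl ; (Fin.suc j) → g≗ j }

minimiser : {A : Set} {Q : A → Set} → Decidable Q → (cost : A → ℕ) (enum : ℕ → List A) →
  (∀ {k x} → Q x → cost x ℕ.≤ k → ∃ λ y → y ∈ enum k × Q y × cost y ℕ.≤ cost x) →
  ∀ {x₀} → Q x₀ → ∃ λ m → Q m × (∀ x → Q x → cost m ℕ.≤ cost x)
minimiser {A} {Q} Q? cost enum enum-complete {x₀} Qx₀ = m , Qm , minimal
  where
  good : List A
  good = filter Q? (enum (cost x₀))
  m : A
  m = argmin cost x₀ good
  Qm : Q m
  Qm = argmin-all cost Qx₀ (AllP.all-filter Q? (enum (cost x₀)))
  minimal : ∀ x → Q x → cost m ℕ.≤ cost x
  minimal x Qx with cost x ℕ.≤? cost x₀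
  ... | no  x≰x₀ = ℕP.≤-trans (f[argmin]≤f[⊤] {f = cost} x₀ good) (ℕP.<⇒≤ (ℕP.≰⇒> x≰x₀))
  ... | yes x≤x₀ with enum-complete Qx x≤x₀
  ...   | y , y∈enum , Qy , y≤x =
    ℕP.≤-trans (All.lookup (f[argmin]≤f[xs] {f = cost} x₀ good) (∈-filter⁺ Q? y∈enum Qy)) y≤x

interval : ℤ → ℕ → List ℤ
interval a k = map (λ i → a + + i) (upTo k)

length-interval : ∀ a k → length (interval a k) ≡ k
length-interval a k = trans (ListP.length-map _ (upTo k)) (ListP.length-upTo k)

interval-unique : ∀ a k → Unique (interval a k)
interval-unique a k = UniqueP.map⁺ a+i≡a+j⇒i≡j (UniqueP.upTo⁺ k)
  where
  a+i≡a+j⇒i≡j : ∀ {i j} → a + + i ≡ a + + j → i ≡ j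
  a+i≡a+j⇒i≡j {i} {j} eq = ℤP.+-injective (begin
    + i             ≡⟨ -a+[a+x]≡x a (+ i) ⟨
    - a + (a + + i) ≡⟨ cong (λ x → - a + x) eq ⟩
    - a + (a + + j) ≡⟨ -a+[a+x]≡x a (+ j) ⟩
    + j             ∎)
    where
    open ≡-Reasoning
    -a+[a+x]≡x : ∀ a x → - a + (a + x) ≡ x
    -a+[a+x]≡x = solve-∀

∈-interval⁻ : ∀ {a k t} → t ∈ interval a k → a ≤ t × t < a + + k
∈-interval⁻ {a} t∈ with ∈-map⁻ _ t∈
... | i , i∈ , refl = ℤP.i≤i+j a (+ i) , ℤP.+-monoʳ-< a (+<+ (∈-upTo⁻ i∈))

+∣b-a∣≡b-a : ∀ {a b} → a ≤ b → + ℤ.∣ b - a ∣ ≡ b - a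
+∣b-a∣≡b-a a≤b = ℤP.0≤i⇒+∣i∣≡i (ℤP.i≤j⇒0≤j-i a≤b)

a+∣b-a∣≡b : ∀ {a b} → a ≤ b → a + + ℤ.∣ b - a ∣ ≡ b
a+∣b-a∣≡b {a} {b} a≤b = trans (cong (λ x → a + x) (+∣b-a∣≡b-a a≤b)) (a+[x-a]≡x a b)
  where
  a+[x-a]≡x : ∀ a x → a + (x - a) ≡ x
  a+[x-a]≡x = solve-∀

∈-interval⁺ : ∀ {a k t} → a ≤ t → t < a + + k → t ∈ interval a k
∈-interval⁺ {a} {k} {t} a≤t t<a+k =
  subst (_∈ interval a k) (a+∣b-a∣≡b a≤t) (∈-map⁺ _ (∈-upTo⁺ (ℤP.drop‿+<+ i<k)))
  where
  i<k : + ℤ.∣ t - a ∣ < + k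
  i<k = subst₂ _<_ (sym (+∣b-a∣≡b-a a≤t)) (a+x-a≡x a (+ k)) (ℤP.+-monoˡ-< (- a) t<a+k)
    where
    a+x-a≡x : ∀ a x → a + x - a ≡ x
    a+x-a≡x = solve-∀

range : ℤ → ℤ → List ℤ
range a b = interval a ℤ.∣ b - a ∣

∈-range⁺ : ∀ {a b t} → a ≤ t → t < b → t ∈ range a b
∈-range⁺ a≤t t<b = ∈-interval⁺ a≤t (subst (_ <_) (sym (a+∣b-a∣≡b (ℤP.≤-trans a≤t (ℤP.<⇒≤ t<b)))) t<b)

calibratedBy-suc : ∀ T {c t} → CalibratedBy T c t → CalibratedBy T (sucℤ c) (sucℤ t)
calibratedBy-suc T {c} {t} (c≤t , t<c+T) =
  ℤP.suc-mono c≤t , subst (sucℤ t <_) (sym (ℤP.+-assoc 1ℤ c (+ T))) (ℤP.+-monoʳ-< 1ℤ t<c+T)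

calibratedBy-delay : ∀ T {c t} → c < t → CalibratedBy T c t → CalibratedBy T (sucℤ c) t
calibratedBy-delay T {c} c<t (_ , t<c+T) =
  ℤP.i<j⇒suc[i]≤j c<t , ℤP.<-≤-trans t<c+T (ℤP.+-monoˡ-≤ (+ T) (ℤP.i≤suc[i] c))

x<1+x : ∀ x → x < sucℤ x
x<1+x x = ℤP.suc[i]≤j⇒i<j ℤP.≤-refl

sucℤ-injective : ∀ {x y} → sucℤ x ≡ sucℤ y → x ≡ y
sucℤ-injective {x} {y} eq = trans (sym (ℤP.pred-suc x)) (trans (cong ℤ.pred eq) (ℤP.pred-suc y))

bump : ℤ → ℤ → ℤ → ℤ
bump c e x with c ≤? x ×-dec x ≤? e
... | yes _ = sucℤ x
... | no  _ = x

data BumpView (c e x : ℤ) : ℤ → Set where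
  shifted : c ≤ x → x ≤ e → BumpView c e x (sucℤ x)
  fixed   : ¬ (c ≤ x × x ≤ e) → BumpView c e x x

bump-view : ∀ c e x → BumpView c e x (bump c e x)
bump-view c e x with c ≤? x ×-dec x ≤? e
... | yes (c≤x , x≤e) = shifted c≤x x≤e
... | no  ¬inside     = fixed ¬inside

bump-shifted : ∀ {c e x} → c ≤ x → x ≤ e → bump c e x ≡ sucℤ x
bump-shifted {c} {e} {x} c≤x x≤e with bump c e x | bump-view c e x
... | _ | shifted _ _    = refl
... | _ | fixed ¬inside = ⊥-elim (¬inside (c≤x , x≤e))

x≤bump[x] : ∀ c e x → x ≤ bump c e x
x≤bump[x] c e x with bump c e x | bump-view c e x
... | _ | shifted _ _ = ℤP.i≤suc[i] x
... | _ | fixed _     = ℤP.≤-refl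

suc-stays-inside : ∀ {c e x} → c ≤ x → x ≤ e → x ≢ e → c ≤ sucℤ x × sucℤ x ≤ e
suc-stays-inside {x = x} c≤x x≤e x≢e =
  ℤP.≤-trans c≤x (ℤP.i≤suc[i] x) , ℤP.i<j⇒suc[i]≤j (ℤP.≤∧≢⇒< x≤e x≢e)

bump-injective : ∀ {c e x y} → x ≢ e → y ≢ e → bump c e x ≡ bump c e y → x ≡ y
bump-injective {c} {e} {x} {y} x≢e y≢e eq
  with bump c e x | bump-view c e x | bump c e y | bump-view c e y
... | _ | shifted _ _ | _ | shifted _ _ = sucℤ-injective eq
... | _ | shifted c≤x x≤e | _ | fixed ¬inside =
  ⊥-elim (¬inside (subst _ eq (suc-stays-inside c≤x x≤e x≢e)))
... | _ | fixed ¬inside | _ | shifted c≤y y≤e =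
  ⊥-elim (¬inside (subst _ (sym eq) (suc-stays-inside c≤y y≤e y≢e)))
... | _ | fixed _ | _ | fixed _ = eq

bump-covering : ∀ T {c e t c₀} → CalibratedBy T c₀ t →
  CalibratedBy T (bump c e c) (bump c e t) ⊎ CalibratedBy T (bump c e c₀) (bump c e t)
bump-covering T {c} {e} {t} {c₀} c₀-cal@(c₀≤t , t<c₀+T) with bump c e t | bump-view c e t
... | _ | shifted c≤t t≤e with t <? c + + T
...   | yes t<c+T = inj₁ (subst (λ b → CalibratedBy T b (sucℤ t))
                           (sym (bump-shifted ℤP.≤-refl (ℤP.≤-trans c≤t t≤e)))
                           (calibratedBy-suc T (c≤t , t<c+T)))
...   | no  t≮c+T = inj₂ (subst (λ b → CalibratedBy T b (sucℤ t))
                           (sym (bump-shifted (ℤP.<⇒≤ c<c₀) (ℤP.≤-trans c₀≤t t≤e)))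
                           (calibratedBy-suc T c₀-cal))
  where
  c<c₀ : c < c₀
  c<c₀ = ℤP.≰⇒> λ c₀≤c → t≮c+T (ℤP.<-≤-trans t<c₀+T (ℤP.+-monoˡ-≤ (+ T) c₀≤c))
bump-covering T {c} {e} {t} {c₀} c₀-cal@(c₀≤t , _) | _ | fixed t∉[c,e] with bump c e c₀ | bump-view c e c₀
... | _ | fixed _            = inj₂ c₀-cal
... | _ | shifted c≤c₀ c₀≤e = inj₂ (calibratedBy-delay T c₀<t c₀-cal)
  where
  c₀<t : c₀ < t
  c₀<t = ℤP.≤-<-trans c₀≤e (ℤP.≰⇒> λ t≤e → t∉[c,e] (ℤP.≤-trans c≤c₀ c₀≤t , t≤e))

bump-calibrated : ∀ T {c e t cs} → c ∈ cs → Calibrated T cs t →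
  Calibrated T (map (bump c e) cs) (bump c e t)
bump-calibrated T {c} {e} c∈cs t-cal with find t-cal
... | c₀ , c₀∈cs , c₀-cal with bump-covering T {c} {e} c₀-cal
...   | inj₁ c-covers  = AnyP.map⁺ (lose c∈cs c-covers)
...   | inj₂ c₀-covers = AnyP.map⁺ (lose c₀∈cs c₀-covers)

calibrated? : ∀ T cs t → Dec (Calibrated T cs t)
calibrated? T cs t = Any.any? (λ c → (c ≤? t) ×-dec (t <? c + + T)) cs

module _ {n : ℕ} (I : Instance n) where
  open Instance I

  private
    P : ℕ
    P = totalP I

  InΨ? : ∀ x → Dec (InΨ I x)
  InΨ? x = FinP.any? λ i → (d i - + P ≤? x) ×-dec (x ≤? d i)

  ¬InΨ⇒c+1+P≤d : ∀ {c} j → ¬ InΨ I c → c ≤ d j → c + + suc P ≤ d j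
  ¬InΨ⇒c+1+P≤d {c} j c∉Ψ c≤dj = begin
    c + + suc P     ≡⟨ x+[1+y]≡[1+x]+y c (+ P) ⟩
    sucℤ c + + P    ≤⟨ ℤP.+-monoˡ-≤ (+ P) (ℤP.i<j⇒suc[i]≤j c<dj-P) ⟩
    d j - + P + + P ≡⟨ x-y+y≡x (d j) (+ P) ⟩
    d j             ∎
    where
    open ℤP.≤-Reasoning
    c<dj-P : c < d j - + P
    c<dj-P = ℤP.≰⇒> λ dj-P≤c → c∉Ψ (j , dj-P≤c , c≤dj)
    x+[1+y]≡[1+x]+y : ∀ x y → x + (1ℤ + y) ≡ (1ℤ + x) + y
    x+[1+y]≡[1+x]+y = solve-∀
    x-y+y≡x : ∀ x y → x - y + y ≡ x
    x-y+y≡x = solve-∀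

  InΨ-suc : ∀ {c x} → ¬ InΨ I c → c ≤ x → x < c + + suc P → InΨ I x → InΨ I (sucℤ x)
  InΨ-suc {c} {x} c∉Ψ c≤x x<c+1+P (i , di-P≤x , x≤di) =
    i , ℤP.≤-trans di-P≤x (ℤP.i≤suc[i] x) ,
    ℤP.i<j⇒suc[i]≤j (ℤP.<-≤-trans x<c+1+P (¬InΨ⇒c+1+P≤d i c∉Ψ (ℤP.≤-trans c≤x x≤di)))

  bump-<-deadline : ∀ {c e t} j → ¬ InΨ I c → e < c + + suc P → t ≢ e → t < d j → bump c e t < d j
  bump-<-deadline {c} {e} {t} j c∉Ψ e<c+1+P t≢e t<dj with bump c e t | bump-view c e t
  ... | _ | fixed _         = t<dj
  ... | _ | shifted c≤t t≤e =
    ℤP.≤-<-trans (ℤP.i<j⇒suc[i]≤j (ℤP.≤∧≢⇒< t≤e t≢e))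
      (ℤP.<-≤-trans e<c+1+P (¬InΨ⇒c+1+P≤d j c∉Ψ (ℤP.≤-trans c≤t (ℤP.<⇒≤ t<dj))))

  deadlineBound : ℤ
  deadlineBound = max 0ℤ (map d (allFin n))

  d≤deadlineBound : ∀ j → d j ≤ deadlineBound
  d≤deadlineBound j = All.lookup (xs≤max 0ℤ (map d (allFin n))) (∈-map⁺ d (∈-allFin j))

  module _ (D : ℤ) where

    Bad : ℤ → Set
    Bad x = ¬ InΨ I x × x < D

    Bad? : ∀ x → Dec (Bad x)
    Bad? x = ¬? (InΨ? x) ×-dec (x <? D)

    badness : ℤ → ℕ
    badness x with Bad? x
    ... | yes _ = ℤ.∣ x - D ∣
    ... | no  _ = 0

    totalBadness : List ℤ → ℕ
    totalBadness xs = sum (map badness xs)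

    badness-bad : ∀ {x} → Bad x → badness x ≡ ℤ.∣ x - D ∣
    badness-bad {x} bad with Bad? x
    ... | yes _    = refl
    ... | no  ¬bad = ⊥-elim (¬bad bad)

    badness-good : ∀ {x} → ¬ Bad x → badness x ≡ 0
    badness-good {x} ¬bad with Bad? x
    ... | yes bad = ⊥-elim (¬bad bad)
    ... | no  _   = refl

    ∣-D∣-mono-< : ∀ {x y} → x < y → y ≤ D → ℤ.∣ y - D ∣ ℕ.< ℤ.∣ x - D ∣
    ∣-D∣-mono-< {x} {y} x<y y≤D = ℤP.drop‿+<+ (subst₂ _<_ (sym (ℤP.∣-∣-≤ y≤D)) (sym (ℤP.∣-∣-≤ x≤D))
      (ℤP.+-monoʳ-< D (ℤP.neg-mono-< x<y)))
      where
      x≤D : x ≤ D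
      x≤D = ℤP.<⇒≤ (ℤP.<-≤-trans x<y y≤D)

    badness-suc-< : ∀ {x} → Bad x → badness (sucℤ x) ℕ.< badness x
    badness-suc-< {x} bad@(_ , x<D) = by-cases (Bad? (sucℤ x))
      where
      by-cases : Dec (Bad (sucℤ x)) → badness (sucℤ x) ℕ.< badness x
      by-cases (yes bad′@(_ , 1+x<D)) = subst₂ ℕ._<_ (sym (badness-bad bad′)) (sym (badness-bad bad))
                                          (∣-D∣-mono-< (x<1+x x) (ℤP.<⇒≤ 1+x<D))
      by-cases (no  ¬bad′)            = subst₂ ℕ._<_ (sym (badness-good ¬bad′)) (sym (badness-bad bad))
                                          (ℕP.≤-<-trans z≤n (∣-D∣-mono-< x<D ℤP.≤-refl))

    ¬Bad-suc : ∀ {c x} → ¬ InΨ I c → c ≤ x → x < c + + suc P → ¬ Bad x → ¬ Bad (sucℤ x)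
    ¬Bad-suc {x = x} c∉Ψ c≤x x<c+1+P ¬bad with InΨ? x
    ... | yes x∈Ψ = λ (1+x∉Ψ , _) → 1+x∉Ψ (InΨ-suc c∉Ψ c≤x x<c+1+P x∈Ψ)
    ... | no  x∉Ψ = λ (_ , 1+x<D) → ¬bad (x∉Ψ , ℤP.<-trans (x<1+x _) 1+x<D)

    badness-bump-≤ : ∀ {c e} → ¬ InΨ I c → e < c + + suc P → ∀ x → badness (bump c e x) ℕ.≤ badness x
    badness-bump-≤ {c} {e} c∉Ψ e<c+1+P x with bump c e x | bump-view c e x
    ... | _ | fixed _ = ℕP.≤-refl
    ... | _ | shifted c≤x x≤e = by-cases (Bad? x)
      where
      by-cases : Dec (Bad x) → badness (sucℤ x) ℕ.≤ badness x
      by-cases (yes bad) = ℕP.<⇒≤ (badness-suc-< bad)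
      by-cases (no ¬bad) = subst (ℕ._≤ badness x)
        (sym (badness-good (¬Bad-suc c∉Ψ c≤x (ℤP.≤-<-trans x≤e e<c+1+P) ¬bad))) z≤n

    totalBadness-bump : ∀ {c e cs} → Bad c → c ∈ cs → c ≤ e → e < c + + suc P →
      totalBadness (map (bump c e) cs) ℕ.< totalBadness cs
    totalBadness-bump {c} {e} {cs} bad c∈cs c≤e e<c+1+P =
      subst (ℕ._< totalBadness cs) (cong sum (ListP.map-∘ cs))
        (sum-map-< (badness ∘ bump c e) badness cs
          (All.tabulate λ {x} _ → badness-bump-≤ (proj₁ bad) e<c+1+P x) (lose c∈cs c-improves))
      where
      c-improves : badness (bump c e c) ℕ.< badness c
      c-improves =
        subst (λ b → badness b ℕ.< badness c) (sym (bump-shifted ℤP.≤-refl c≤e)) (badness-suc-< bad)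

  Ψwindow : Fin n → List ℤ
  Ψwindow i = range (d i - + P) (sucℤ (d i))

  ΨList : List ℤ
  ΨList = concatMap Ψwindow (allFin n)

  ∈-ΨList : ∀ {x} → InΨ I x → x ∈ ΨList
  ∈-ΨList (i , di-P≤x , x≤di) =
    ∈-concatMap⁺ Ψwindow (lose (∈-allFin i) (∈-range⁺ di-P≤x (ℤP.≤-<-trans x≤di (x<1+x (d i)))))

  slotLists : (j : Fin n) → List (List ℤ)
  slotLists j = listsOfLength (p j) (range (r j) (d j))

  candidates : ℕ → List (Schedule n)
  candidates k =
    concatMap (λ cs → map (λ ss → record { cals = cs ; slots = ss }) (choices slotLists))
      (listsOfLength≤ k ΨList)

  module _ (T : ℕ) where

    busy : Schedule n → List ℤ
    busy S = concatMap (slots S) (allFin n)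

    ∈-busy : ∀ S j {t} → t ∈ slots S j → t ∈ busy S
    ∈-busy S j t∈ = ∈-concatMap⁺ (slots S) (lose (∈-allFin j) t∈)

    length-busy : ∀ {S} → Feasible I T S → length (busy S) ≡ P
    length-busy {S} F =
      trans (length-concatMap (slots S) (allFin n)) (cong sum (ListP.map-cong (Feasible.count F) (allFin n)))

    freeSlot : ∀ {S} → Feasible I T S → ∀ c → ∃ λ e → e ∈ interval c (suc P) × e ∉ busy S
    freeSlot {S} F c = find (AllP.¬All⇒Any¬ (_∈? busy S) (interval c (suc P)) λ interval⊆busy →
      ℕP.1+n≰n (begin
        suc P                         ≡⟨ length-interval c (suc P) ⟨
        length (interval c (suc P))   ≤⟨ Unique-⊆⇒length≤ (interval-unique c (suc P))
                                                            (All.lookup interval⊆busy) ⟩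
        length (busy S)               ≡⟨ length-busy F ⟩
        P                             ∎))
      where open ℕP.≤-Reasoning

    retime : (ℤ → ℤ) → Schedule n → Schedule n
    retime f S = record { cals = map f (cals S) ; slots = λ j → map f (slots S j) }

    retime-feasible : ∀ {S} (f : ℤ → ℤ) → Feasible I T S →
      (∀ {x y} → x ∈ busy S → y ∈ busy S → f x ≡ f y → x ≡ y) →
      (∀ j {t} → t ∈ slots S j → r j ≤ f t × f t < d j) →
      (∀ j {t} → t ∈ slots S j → Calibrated T (map f (cals S)) (f t)) →
      Feasible I T (retime f S)
    retime-feasible {S} f F injective f-window f-calib = record
      { count    = λ j → trans (ListP.length-map f (slots S j)) (count j)
      ; distinct = λ j → Unique-map⁺-on f (λ x∈ y∈ → injective (∈-busy S j x∈) (∈-busy S j y∈)) (distinct j)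
      ; window   = λ j → AllP.map⁺ (All.tabulate (f-window j))
      ; calib    = λ j → AllP.map⁺ (All.tabulate (f-calib j))
      ; disjoint = λ i j t t∈i t∈j →
          let x , x∈i , t≡fx = ∈-map⁻ f t∈i
              y , y∈j , t≡fy = ∈-map⁻ f t∈j
              x≡y = injective (∈-busy S i x∈i) (∈-busy S j y∈j) (trans (sym t≡fx) t≡fy)
          in disjoint i j x x∈i (subst (_∈ slots S j) (sym x≡y) y∈j)
      }
      where open Feasible F

    bump-feasible : ∀ {S c e} → Feasible I T S → c ∈ cals S → ¬ InΨ I c → e ∉ busy S → e < c + + suc P →
      Feasible I T (retime (bump c e) S)
    bump-feasible {S} {c} {e} F c∈cals c∉Ψ e∉busy e<c+1+P = retime-feasible (bump c e) F
      (λ x∈ y∈ → bump-injective {c} (≢e x∈) (≢e y∈))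
      (λ j {t} t∈ → let r≤t , t<d = All.lookup (window j) t∈
                    in ℤP.≤-trans r≤t (x≤bump[x] c e t) ,
                       bump-<-deadline j c∉Ψ e<c+1+P (≢e (∈-busy S j t∈)) t<d)
      (λ j t∈ → bump-calibrated T c∈cals (All.lookup (calib j) t∈))
      where
      open Feasible F
      ≢e : ∀ {t} → t ∈ busy S → t ≢ e
      ≢e t∈busy refl = e∉busy t∈busy

    eliminateBad : ∀ D {S} → Feasible I T S →
      ∃ λ S′ → Feasible I T S′ × length (cals S′) ≡ length (cals S) × All (¬_ ∘ Bad D) (cals S′)
    eliminateBad D {S} F = go S F (<-wellFounded (totalBadness D (cals S)))
      where
      go : ∀ S → Feasible I T S → Acc ℕ._<_ (totalBadness D (cals S)) →
        ∃ λ S′ → Feasible I T S′ × length (cals S′) ≡ length (cals S) × All (¬_ ∘ Bad D) (cals S′)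
      go S F (acc smaller) with Any.any? (Bad? D) (cals S)
      ... | no  ¬someBad = S , F , refl , AllP.¬Any⇒All¬ (cals S) ¬someBad
      ... | yes someBad =
        let c , c∈cals , c-bad = find someBad
            e , e∈ , e∉busy    = freeSlot F c
            c≤e , e<c+1+P      = ∈-interval⁻ e∈
            S′ , F′ , same-length , noBad = go (retime (bump c e) S)
              (bump-feasible F c∈cals (proj₁ c-bad) e∉busy e<c+1+P)
              (smaller (totalBadness-bump D c-bad c∈cals c≤e e<c+1+P))
        in S′ , F′ , trans same-length (ListP.length-map (bump c e) (cals S)) , noBad

    filterΨ-feasible : ∀ {S} → Feasible I T S → All (¬_ ∘ Bad deadlineBound) (cals S) →
      Feasible I T (record S { cals = filter InΨ? (cals S) })
    filterΨ-feasible {S} F noBad = record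
      { count = count ; distinct = distinct ; window = window ; disjoint = disjoint
      ; calib = λ j → All.tabulate λ t∈ → calibratedInΨ (All.lookup (window j) t∈) (All.lookup (calib j) t∈)
      }
      where
      open Feasible F
      calibratedInΨ : ∀ {j t} → r j ≤ t × t < d j → Calibrated T (cals S) t →
        Calibrated T (filter InΨ? (cals S)) t
      calibratedInΨ {j} (_ , t<dj) t-cal with find t-cal
      ... | c , c∈cals , c-cal@(c≤t , _) = lose (∈-filter⁺ InΨ? c∈cals c∈Ψ) c-cal
        where
        c∈Ψ : InΨ I c
        c∈Ψ = decidable-stable (InΨ? c) λ c∉Ψ →
          All.lookup noBad c∈cals (c∉Ψ , ℤP.≤-<-trans c≤t (ℤP.<-≤-trans t<dj (d≤deadlineBound j)))

    normalise : ∀ {S} → Feasible I T S →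
      ∃ λ S′ → Feasible I T S′ × length (cals S′) ℕ.≤ length (cals S) × All (InΨ I) (cals S′)
    normalise F with eliminateBad deadlineBound F
    ... | S , F′ , same-length , noBad =
      record S { cals = filter InΨ? (cals S) } , filterΨ-feasible F′ noBad ,
      ℕP.≤-trans (ListP.length-filter InΨ? (cals S)) (ℕP.≤-reflexive same-length) ,
      AllP.all-filter InΨ? (cals S)

    feasible? : ∀ S → Dec (Feasible I T S)
    feasible? S = map′
      (λ (count , distinct , window , calib , disjoint) → record
        { count = count ; distinct = distinct ; window = window ; calib = calib
        ; disjoint = λ i j t t∈i → All.lookup (disjoint i j) t∈i })
      (λ F → let open Feasible F in
        count , distinct , window , calib , λ i j → All.tabulate (disjoint i j _))
      (     FinP.all? (λ j → length (slots S j) ℕ.≟ p j)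
      ×-dec FinP.all? (λ j → unique? (slots S j))
      ×-dec FinP.all? (λ j → All.all? (λ t → (r j ≤? t) ×-dec (t <? d j)) (slots S j))
      ×-dec FinP.all? (λ j → All.all? (calibrated? T (cals S)) (slots S j))
      ×-dec FinP.all? (λ i → FinP.all? λ j →
              All.all? (λ t → (t ∈? slots S j) →-dec (i FinP.≟ j)) (slots S i)))

    Feasible-slots-≗ : ∀ {S} (ss : Fin n → List ℤ) → (∀ j → ss j ≡ slots S j) → Feasible I T S →
      Feasible I T (record S { slots = ss })
    Feasible-slots-≗ ss ss≗ F = record
      { count    = λ j → trans (cong length (ss≗ j)) (count j)
      ; distinct = λ j → subst Unique (sym (ss≗ j)) (distinct j)
      ; window   = λ j → subst (All _) (sym (ss≗ j)) (window j)
      ; calib    = λ j → subst (All _) (sym (ss≗ j)) (calib j)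
      ; disjoint = λ i j t t∈i t∈j → disjoint i j t (subst (t ∈_) (ss≗ i) t∈i) (subst (t ∈_) (ss≗ j) t∈j)
      }
      where open Feasible F

    ΨFeasible : Schedule n → Set
    ΨFeasible S = Feasible I T S × All (InΨ I) (cals S)

    ΨFeasible? : ∀ S → Dec (ΨFeasible S)
    ΨFeasible? S = feasible? S ×-dec All.all? InΨ? (cals S)

    ∈-candidates : ∀ {k S} → ΨFeasible S → length (cals S) ℕ.≤ k →
      ∃ λ S′ → S′ ∈ candidates k × ΨFeasible S′ × length (cals S′) ℕ.≤ length (cals S)
    ∈-candidates {k} {S} (F , allΨ) ≤k with ∈-choices slotLists slots∈
      where
      open Feasible F
      slots∈ : ∀ j → slots S j ∈ slotLists j
      slots∈ j = subst (λ m → slots S j ∈ listsOfLength m _) (count j)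
        (∈-listsOfLength (All.map (λ (r≤t , t<d) → ∈-range⁺ r≤t t<d) (window j)))
    ... | ss , ss∈ , ss≗ =
      record S { slots = ss } ,
      ∈-concatMap⁺ _ (lose (∈-listsOfLength≤ ≤k (All.map ∈-ΨList allΨ)) (∈-map⁺ _ ss∈)) ,
      (Feasible-slots-≗ ss ss≗ F , allΨ) ,
      ℕP.≤-refl

proposition1 : (n : ℕ) (I : Instance n) (T : ℕ) →
    (∀ (j : Fin n) → 1 ℕ.≤ Instance.p I j) →
    ∃ (λ S → Feasible I T S) →
    ∃ (λ S → Optimal I T S × All (InΨ I) (cals S))
proposition1 n I T _ (S₀ , F₀) with normalise I T F₀
... | _ , F₁ , _ , allΨ₁
  with minimiser (ΨFeasible? I T) (length ∘ cals) (candidates I) (∈-candidates I T) (F₁ , allΨ₁)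
... | S , (F , allΨ) , minimal = S , (F , optimal) , allΨ
  where
  optimal : ∀ S′ → Feasible I T S′ → length (cals S) ℕ.≤ length (cals S′)
  optimal S′ F′ with normalise I T F′
  ... | S″ , F″ , S″≤S′ , allΨ″ = ℕP.≤-trans (minimal S″ (F″ , allΨ″)) S″≤S′
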